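{- If $(\mathcal V,\mathcal T_\#)$ is a basic neighborhood space, then there is an identical automorphism $f$ of $(\mathcal V,\mathcal T_\#)$ such that for every $x\in\mathcal V$ and every $n\in\mathbb N$ the basic dot $f(x)_n$ is a basic neighborhood of $f(x)$.
   Context: Setting: Bishop-style constructive mathematics. Pre-natural space $(V,\#,\preccurlyeq)$: $V$ countable, $\#,\preccurlyeq$ decidable, $\#$ symmetric irreflexive, $\preccurlyeq$ partial order, $a\preccurlyeq b\wedge c\#b\Rightarrow c\#a$; $a\prec b$ means $a\preccurlyeq b,a\ne b$. Points: sequences $(p_n)$ in $V$ with $p_{n+1}\preccurlyeq p_n$, each $n$ some $m$ with $p_m\prec p_n$, and for every $a\#b$ some $m$ with $p_m\#a$ or $p_m\#b$; $\mathcal V$ = points; $p\#q$ iff $\exists n\,p_n\#q_n$, $p\equiv q$ iff not $p\#q$; $\hat a=\{p:\exists m\,p_m\prec a\}$, $\bar a$ its $\equiv$-closure; $U$ open iff for all $x\in U,y\in\mathcal V$ one can determine $y\#x$ or $\widehat{y_m}\subseteq U$ for some $m$. Natural space: a maximal dot exists and each $\hat a$ inhabited. Morphisms: a refinement morphism is $f:V\to W$ with $f(a)\#f(b)\Rightarrow a\#b$, $a\preccurlyeq b\Rightarrow f(a)\preccurlyeq f(b)$, mapping points to points via $(f(p_n))_n$. Trail morphisms: for a point $p$ let $\psi_p(n)$ be $p_0,\dots,p_{n-1}$ with repetitions deleted; the trail space has as basic dots these finite strictly decreasing sequences, ordered by "extends", with two trails apart iff their last elements are apart; a trail morphism is a refinement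 morphism $f$ from the trail space, acting by $f(p)=(f(\psi_p(n)))_n$. A natural morphism is a refinement or trail morphism; $f(x)_n$ denotes the $n$-th dot of $f(x)$. An isomorphism is a morphism $f$ with a morphism $g$ in the opposite direction such that $g(f(x))\equiv x$ and $f(g(y))\equiv y$ for all points; an automorphism is an isomorphism of a space to itself, identical if $f(x)\equiv x$ for all $x$. For $x\in\hat a$, $a$ is a basic neighborhood of $x$ iff $\bar a$ is a neighborhood of $x$ in the apartness topology. A natural space is basic-open if $\bar a$ is open for every $a$, and a basic neighborhood space if it is isomorphic to a basic-open space. -}

module Defs where

open import Data.Nat using (ℕ; zero; suc)
open import Data.List using (List; []; _∷_; _++_)
open import Data.Product using (Σ; ∃; _×_; _,_; proj₁; proj₂)
open import Data.Sum using (_⊎_; inj₁; inj₂)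
open import Data.Empty using (⊥)
open import Data.Unit using (⊤)
open import Relation.Nullary using (¬_; Dec; yes; no)
open import Relation.Binary.PropositionalEquality using (_≡_; _≢_)
open import Level using (Level) renaming (suc to lsuc; zero to lzero)

record PreNatural : Set₁ where
  infix 4 _#_ _≼_ _≺_
  field
    Dot     : Set
    -- V countable: enumerated by ℕ, with decidable equality of dots
    enum      : ℕ → Dot
    enum-surj : ∀ a → ∃ λ n → enum n ≡ a
    _≟_     : (a b : Dot) → Dec (a ≡ b)
    _#_     : Dot → Dot → Set
    _≼_     : Dot → Dot → Set
    _#?_    : (a b : Dot) → Dec (a # b)
    _≼?_    : (a b : Dot) → Dec (a ≼ b)
    #-sym   : ∀ {a b} → a # b → b # a
    #-irr   : ∀ {a} → ¬ (a # a)
    ≼-refl  : ∀ {a} → a ≼ a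
    ≼-trans : ∀ {a b c} → a ≼ b → b ≼ c → a ≼ c
    ≼-antisym : ∀ {a b} → a ≼ b → b ≼ a → a ≡ b
    ≼-# : ∀ {a b c} → a ≼ b → c # b → c # a

  _≺_ : Dot → Dot → Set
  a ≺ b = (a ≼ b) × (a ≢ b)

module _ (S : PreNatural) where
  open PreNatural S

  record IsPoint (p : ℕ → Dot) : Set where
    field
      decr   : ∀ n → p (suc n) ≼ p n
      shrink : ∀ n → ∃ λ m → p m ≺ p n
      locate : ∀ a b → a # b → ∃ λ m → (p m # a) ⊎ (p m # b)

  Point : Set
  Point = Σ (ℕ → Dot) IsPoint

  _at_ : Point → ℕ → Dot
  x at n = proj₁ x n

  _#ₚ_ : Point → Point → Set
  x #ₚ y = ∃ λ n → (x at n) # (y at n)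

  _≡ₚ_ : Point → Point → Set
  x ≡ₚ y = ¬ (x #ₚ y)

  hat : Dot → Point → Set
  hat a p = ∃ λ m → (p at m) ≺ a

  bar : Dot → Point → Set
  bar a x = Σ Point λ y → hat a y × (x ≡ₚ y)

  _⊆_ : (Point → Set) → (Point → Set) → Set
  U ⊆ U' = ∀ x → U x → U' x

  IsOpen : (Point → Set) → Set
  IsOpen U = ∀ x y → U x → (y #ₚ x) ⊎ (∃ λ m → hat (y at m) ⊆ U)

  IsNbhd : (Point → Set) → Point → Set₁
  IsNbhd N x = Σ (Point → Set) λ U → IsOpen U × U x × (U ⊆ N)

  BasicNbhd : Dot → Point → Set₁
  BasicNbhd a x = hat a x × IsNbhd (bar a) x

  IsBasicOpen : Set
  IsBasicOpen = ∀ a → IsOpen (bar a)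

  -- trails: finite strictly decreasing sequences, stored with the
  -- LAST (smallest) element at the head of the list
  Trail : List Dot → Set
  Trail [] = ⊤
  Trail (x ∷ []) = ⊤
  Trail (x ∷ y ∷ l) = (x ≺ y) × Trail (y ∷ l)

  Extends : List Dot → List Dot → Set
  Extends t s = ∃ λ u → t ≡ u ++ s

  TrailApart : List Dot → List Dot → Set
  TrailApart (x ∷ _) (y ∷ _) = x # y
  TrailApart _ _ = ⊥

  push : Dot → List Dot → List Dot
  push x [] = x ∷ []
  push x (h ∷ t) with h ≟ x
  ... | yes _ = h ∷ t
  ... | no  _ = x ∷ h ∷ t

  -- ψ_p(n) = p_0,…,p_{n-1} with repetitions deleted (last element first)
  ψ : (ℕ → Dot) → ℕ → List Dot
  ψ p zero    = []
  ψ p (suc n) = push (p n) (ψ p n)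

natural : PreNatural → Set
natural S = (Σ Dot λ top → ∀ b → b ≼ top) × (∀ a → Σ (Point S) (hat S a))
  where open PreNatural S

record NaturalSpace : Set₁ where
  field
    pre   : PreNatural
    isNat : natural pre

module _ (S T : PreNatural) where
  private
    module S = PreNatural S
    module T = PreNatural T

  record RefinementMorphism : Set where
    field
      fun     : S.Dot → T.Dot
      refl-#  : ∀ a b → fun a T.# fun b → a S.# b
      mono    : ∀ {a b} → a S.≼ b → fun a T.≼ fun b
      points  : (p : Point S) → IsPoint T (λ n → fun (proj₁ p n))

  -- a refinement morphism from the trail space of S to T
  -- (only its values on trails matter)
  record TrailMorphism : Set where
    field
      fun     : List S.Dot → T.Dot
      refl-#  : ∀ t s → Trail S t → Trail S s → fun t T.# fun s → TrailApart S t s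
      mono    : ∀ t s → Trail S t → Trail S s → Extends S t s → fun t T.≼ fun s
      points  : (p : Point S) → IsPoint T (λ n → fun (ψ S (proj₁ p) n))

  Morphism : Set
  Morphism = RefinementMorphism ⊎ TrailMorphism

  apply : Morphism → Point S → Point T
  apply (inj₁ f) p = (λ n → RefinementMorphism.fun f (proj₁ p n)) , RefinementMorphism.points f p
  apply (inj₂ f) p = (λ n → TrailMorphism.fun f (ψ S (proj₁ p) n)) , TrailMorphism.points f p

IsIso : (S T : PreNatural) → Morphism S T → Set
IsIso S T f = Σ (Morphism T S) λ g →
  (∀ x → _≡ₚ_ S (apply T S g (apply S T f x)) x) ×
  (∀ y → _≡ₚ_ T (apply S T f (apply T S g y)) y)

Isomorphic : (S T : PreNatural) → Set
Isomorphic S T = Σ (Morphism S T) (IsIso S T)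

IsIdentical : (S : PreNatural) → Morphism S S → Set
IsIdentical S f = ∀ x → _≡ₚ_ S (apply S S f x) x

BasicNbhdSpace : NaturalSpace → Set₁
BasicNbhdSpace V = Σ NaturalSpace λ W →
  IsBasicOpen (NaturalSpace.pre W) × Isomorphic (NaturalSpace.pre V) (NaturalSpace.pre W)

module Submission where

-- Let g : V → W be an isomorphism onto a basic-open space, with inverse h, and let f be
-- the composite h ∘ g, realised as a single natural morphism (when h is a trail morphism,
-- g is first turned into a map of trails). Then f is identical because h ∘ g is, and f x
-- agrees dot by dot with h w for some w ≡ g x. The n-th dot of h w is a basic
-- neighbourhood of h w: the open set w̄ₙ pulls back along g to an open set containing h w,
-- and h maps this set into ā for a = (h w)ₙ. The last step uses splicing: a point of the
-- basic set of yₘ is ≡ to a point starting with y₀, …, yₘ, whose image under a morphism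
-- therefore starts with the same m + 1 dots as the image of y.

open import Defs
open import Function using (_∘_)
open import Level using () renaming (zero to lzero)
open import Data.Nat using (ℕ; zero; suc; _+_; _≤_; _<_; _≤′_; ≤′-refl; ≤′-step; s≤s)
open import Data.Nat.Properties
  using (≤⇒≤′; m≤m+n; m≤n+m; ≤-refl; <⇒≤; m<n⇒m<1+n; n<1+n; +-identityʳ)
open import Data.List using (List; []; _∷_; _++_)
open import Data.List.Properties using (++-assoc; ∷-injective)
open import Data.Product using (Σ; ∃; _×_; _,_; proj₁; proj₂)
open import Data.Sum using (_⊎_; inj₁; inj₂)
open import Data.Empty using (⊥-elim)
open import Data.Unit using (tt)
open import Relation.Nullary using (¬_; yes; no)
open import Relation.Binary.Bundles using (Setoid)
import Relation.Binary.Reasoning.Setoid as SetoidReasoning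
open import Relation.Binary.PropositionalEquality
  using (_≡_; _≗_; refl; sym; trans; cong; cong₂; subst; subst₂)

module PointProperties (S : PreNatural) where
  open PreNatural S

  ≺-≼-trans : ∀ {a b c} → a ≺ b → b ≼ c → a ≺ c
  ≺-≼-trans (a≼b , a≢b) b≼c =
    ≼-trans a≼b b≼c , λ a≡c → a≢b (≼-antisym a≼b (subst (_ ≼_) (sym a≡c) b≼c))

  ≼-≺-trans : ∀ {a b c} → a ≼ b → b ≺ c → a ≺ c
  ≼-≺-trans a≼b (b≼c , b≢c) =
    ≼-trans a≼b b≼c , λ a≡c → b≢c (≼-antisym b≼c (subst (_≼ _) a≡c a≼b))

  #-antitone : ∀ {a a′ b b′} → a′ ≼ a → b′ ≼ b → a # b → a′ # b′
  #-antitone a′≼a b′≼b a#b = #-sym (≼-# a′≼a (#-sym (≼-# b′≼b a#b)))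

  antitone : ∀ {p} → IsPoint S p → ∀ {m n} → m ≤ n → p n ≼ p m
  antitone {p} p-point = go ∘ ≤⇒≤′
    where
      go : ∀ {m n} → m ≤′ n → p n ≼ p m
      go ≤′-refl        = ≼-refl
      go (≤′-step m≤′n) = ≼-trans (IsPoint.decr p-point _) (go m≤′n)

  apart-later : ∀ {p q} → IsPoint S p → IsPoint S q →
    ∀ {m n i} → m ≤ i → n ≤ i → p m # q n → p i # q i
  apart-later p-point q-point m≤i n≤i = #-antitone (antitone p-point m≤i) (antitone q-point n≤i)

  ¬dots-apart : ∀ {p} → IsPoint S p → ∀ m n → ¬ (p m # p n)
  ¬dots-apart p-point m n = #-irr ∘ apart-later p-point p-point (m≤m+n m n) (m≤n+m n m)

  IsPoint-resp-≗ : ∀ {p q} → p ≗ q → IsPoint S p → IsPoint S q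
  IsPoint-resp-≗ p≗q p-point = record
    { decr   = λ n → subst₂ _≼_ (p≗q (suc n)) (p≗q n) (decr n)
    ; shrink = λ n → let m , pₘ≺pₙ = shrink n in m , subst₂ _≺_ (p≗q m) (p≗q n) pₘ≺pₙ
    ; locate = λ a b a#b →
        let m , r = locate a b a#b in m , subst (λ d → (d # a) ⊎ (d # b)) (p≗q m) r
    }
    where open IsPoint p-point

  ≡ₚ-refl : ∀ {x} → _≡ₚ_ S x x
  ≡ₚ-refl (n , xₙ#xₙ) = #-irr xₙ#xₙ

  ≡ₚ-sym : ∀ {x y} → _≡ₚ_ S x y → _≡ₚ_ S y x
  ≡ₚ-sym x≡y (n , yₙ#xₙ) = x≡y (n , #-sym yₙ#xₙ)

  -- y locates the pair xₙ # zₙ, and an apartness of y from x or z persists further down.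
  ≡ₚ-trans : ∀ {x y z} → _≡ₚ_ S x y → _≡ₚ_ S y z → _≡ₚ_ S x z
  ≡ₚ-trans {x , x-point} {y , y-point} {z , z-point} x≡y y≡z (n , xₙ#zₙ)
    with IsPoint.locate y-point (x n) (z n) xₙ#zₙ
  ... | m , inj₁ yₘ#xₙ =
    x≡y (m + n , #-sym (apart-later y-point x-point (m≤m+n m n) (m≤n+m n m) yₘ#xₙ))
  ... | m , inj₂ yₘ#zₙ =
    y≡z (m + n , apart-later y-point z-point (m≤m+n m n) (m≤n+m n m) yₘ#zₙ)

  ≗⇒≡ₚ : ∀ {x y} → proj₁ x ≗ proj₁ y → _≡ₚ_ S x y
  ≗⇒≡ₚ {x} x≗y (n , xₙ#yₙ) = #-irr (subst (proj₁ x n #_) (sym (x≗y n)) xₙ#yₙ)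

  ≡ₚ-setoid : Setoid lzero lzero
  ≡ₚ-setoid = record
    { Carrier       = Point S
    ; _≈_           = _≡ₚ_ S
    ; isEquivalence = record
      { refl  = λ {x} → ≡ₚ-refl {x}
      ; sym   = λ {x} {y} → ≡ₚ-sym {x} {y}
      ; trans = λ {x} {y} {z} → ≡ₚ-trans {x} {y} {z}
      }
    }

  module ≡ₚ-Reasoning = SetoidReasoning ≡ₚ-setoid

module Splicing (S : PreNatural) where
  open PreNatural S
  open PointProperties S

  tail-point : ∀ {p} → IsPoint S p → IsPoint S (p ∘ suc)
  tail-point {p} p-point = record
    { decr   = decr ∘ suc
    ; shrink = λ n → let m , pₘ≺p₁₊ₙ = shrink (suc n) in m , ≼-≺-trans (decr m) pₘ≺p₁₊ₙ
    ; locate = λ a b a#b → let m , r = locate a b a#b in m , below (decr m) r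
    }
    where
      open IsPoint p-point
      below : ∀ {d d′ a b} → d′ ≼ d → (d # a) ⊎ (d # b) → (d′ # a) ⊎ (d′ # b)
      below d′≼d (inj₁ d#a) = inj₁ (#-antitone d′≼d ≼-refl d#a)
      below d′≼d (inj₂ d#b) = inj₂ (#-antitone d′≼d ≼-refl d#b)

  drop-point : ∀ k {p} → IsPoint S p → IsPoint S (λ i → p (k + i))
  drop-point zero    p-point = p-point
  drop-point (suc k) p-point = drop-point k (tail-point p-point)

  prepend : Dot → (ℕ → Dot) → ℕ → Dot
  prepend a q zero    = a
  prepend a q (suc n) = q n

  prepend-point : ∀ {a q} → IsPoint S q → q 0 ≼ a → IsPoint S (prepend a q)
  prepend-point {a} {q} q-point q₀≼a = record
    { decr = decr′ ; shrink = shrink′ ; locate = locate′ }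
    where
      open IsPoint q-point
      decr′ : ∀ n → prepend a q (suc n) ≼ prepend a q n
      decr′ zero    = q₀≼a
      decr′ (suc n) = decr n
      shrink′ : ∀ n → ∃ λ m → prepend a q m ≺ prepend a q n
      shrink′ zero    = let m , qₘ≺q₀ = shrink 0 in suc m , ≺-≼-trans qₘ≺q₀ q₀≼a
      shrink′ (suc n) = let m , qₘ≺qₙ = shrink n in suc m , qₘ≺qₙ
      locate′ : ∀ b c → b # c → ∃ λ m → (prepend a q m # b) ⊎ (prepend a q m # c)
      locate′ b c b#c = let m , r = locate b c b#c in suc m , r

  splice : (ℕ → Dot) → (ℕ → Dot) → ℕ → ℕ → Dot
  splice y z zero    = prepend (y 0) z
  splice y z (suc m) = prepend (y 0) (splice (y ∘ suc) z m)

  splice-point : ∀ {y z} m → IsPoint S y → IsPoint S z → z 0 ≺ y m → IsPoint S (splice y z m)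
  splice-point zero y-point z-point z₀≺yₘ = prepend-point z-point (proj₁ z₀≺yₘ)
  splice-point {y} {z} (suc m) y-point z-point z₀≺yₘ =
    prepend-point (splice-point m (tail-point y-point) z-point z₀≺yₘ) (head-≼ m)
    where
      head-≼ : ∀ m → splice (y ∘ suc) z m 0 ≼ y 0
      head-≼ zero    = IsPoint.decr y-point 0
      head-≼ (suc m) = IsPoint.decr y-point 0

  splice-prefix : ∀ y z m {i} → i ≤ m → splice y z m i ≡ y i
  splice-prefix y z zero    {zero}  _         = refl
  splice-prefix y z (suc m) {zero}  _         = refl
  splice-prefix y z (suc m) {suc i} (s≤s i≤m) = splice-prefix (y ∘ suc) z m i≤m

  splice-suffix : ∀ y z m i → splice y z m (suc m + i) ≡ z i
  splice-suffix y z zero    i = refl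
  splice-suffix y z (suc m) i = splice-suffix (y ∘ suc) z m i

  -- The spliced point is y₀, …, yₘ, zₖ, zₖ₊₁, …; an apartness from z at index n would
  -- persist to index m + 1 + n, where it would separate two dots of z.
  splice-hat : (y z : Point S) (m : ℕ) → hat S (proj₁ y m) z →
    Σ (Point S) λ z′ → _≡ₚ_ S z′ z × (∀ {i} → i ≤ m → proj₁ z′ i ≡ proj₁ y i)
  splice-hat (y , y-point) (z , z-point) m (k , zₖ≺yₘ) =
    (s , s-point) , s≡z , splice-prefix y (λ i → z (k + i)) m
    where
      s : ℕ → Dot
      s = splice y (λ i → z (k + i)) m
      s-point : IsPoint S s
      s-point = splice-point m y-point (drop-point k z-point)
        (subst (λ j → z j ≺ y m) (sym (+-identityʳ k)) zₖ≺yₘ)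
      s≡z : _≡ₚ_ S (s , s-point) (z , z-point)
      s≡z (n , sₙ#zₙ) = ¬dots-apart z-point (k + n) (suc m + n)
        (subst (_# z (suc m + n)) (splice-suffix y (λ i → z (k + i)) m n)
          (apart-later s-point z-point (m≤n+m n (suc m)) (m≤n+m n (suc m)) sₙ#zₙ))

module TrailProperties (S : PreNatural) where
  open PreNatural S

  push-head : ∀ x l → ∃ λ l′ → push S x l ≡ x ∷ l′
  push-head x []      = [] , refl
  push-head x (h ∷ t) with h ≟ x
  ... | yes h≡x = t , cong (_∷ t) h≡x
  ... | no  _   = h ∷ t , refl

  push-cases : ∀ x l → (push S x l ≡ x ∷ l) ⊎
    (Σ Dot λ h → Σ (List Dot) λ t → (l ≡ h ∷ t) × (push S x l ≡ l))
  push-cases x []      = inj₁ refl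
  push-cases x (h ∷ t) with h ≟ x
  ... | yes _ = inj₂ (h , t , refl , refl)
  ... | no  _ = inj₁ refl

  push-repeat : ∀ {h x t} → h ≡ x → push S x (h ∷ t) ≡ h ∷ t
  push-repeat {h} {x} h≡x with h ≟ x
  ... | yes _   = refl
  ... | no  h≢x = ⊥-elim (h≢x h≡x)

  push-extends : ∀ x l → Extends S (push S x l) l
  push-extends x []      = x ∷ [] , refl
  push-extends x (h ∷ t) with h ≟ x
  ... | yes _ = [] , refl
  ... | no  _ = x ∷ [] , refl

  extends-trans : ∀ {t s r} → Extends S t s → Extends S s r → Extends S t r
  extends-trans {r = r} (u , refl) (v , refl) = u ++ v , sym (++-assoc u v r)

  push-trail : ∀ x l → Trail S l → (∀ {y l′} → l ≡ y ∷ l′ → x ≼ y) → Trail S (push S x l)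
  push-trail x []      _       _      = tt
  push-trail x (y ∷ l) l-trail x≼head with y ≟ x
  ... | yes _   = l-trail
  ... | no  y≢x = (x≼head refl , λ x≡y → y≢x (sym x≡y)) , l-trail

  trail-tail : ∀ {a t} → Trail S (a ∷ t) → Trail S t
  trail-tail {t = []}    _             = tt
  trail-tail {t = _ ∷ _} (_ , t-trail) = t-trail

  ψ-head : ∀ p n → ∃ λ t → ψ S p (suc n) ≡ p n ∷ t
  ψ-head p n = push-head (p n) (ψ S p n)

  ψ-repeat : ∀ p k → p (suc k) ≡ p k → ψ S p (suc (suc k)) ≡ ψ S p (suc k)
  ψ-repeat p k pₖ₊₁≡pₖ with ψ-head p k
  ... | r , ψₖ₊₁≡pₖ∷r = trans (cong (push S (p (suc k))) ψₖ₊₁≡pₖ∷r)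
                              (trans (push-repeat (sym pₖ₊₁≡pₖ)) (sym ψₖ₊₁≡pₖ∷r))

  ψ-trail : ∀ {p} → IsPoint S p → ∀ n → Trail S (ψ S p n)
  ψ-trail p-point zero = tt
  ψ-trail {p} p-point (suc n) = push-trail (p n) (ψ S p n) (ψ-trail p-point n) (below-head n)
    where
      below-head : ∀ n {y l′} → ψ S p n ≡ y ∷ l′ → p n ≼ y
      below-head (suc k) ψ≡y∷l′ =
        subst (p (suc k) ≼_) (proj₁ (∷-injective (trans (sym (proj₂ (ψ-head p k))) ψ≡y∷l′)))
          (IsPoint.decr p-point k)

  ψ-cong : ∀ {p q} n → (∀ {i} → i < n → p i ≡ q i) → ψ S p n ≡ ψ S q n
  ψ-cong zero    _   = refl
  ψ-cong (suc n) p≡q = cong₂ (push S) (p≡q (n<1+n n)) (ψ-cong n (p≡q ∘ m<n⇒m<1+n))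

module TrailImage (S T : PreNatural)
  (G : PreNatural.Dot S → List (PreNatural.Dot S) → PreNatural.Dot T) where
  private
    module S = PreNatural S
    module T = PreNatural T
    module Tᵗ = TrailProperties T
  open TrailProperties S using (push-cases; trail-tail)

  -- the G-values of the nonempty prefixes of a trail, repetitions deleted
  τ : List S.Dot → List T.Dot
  τ []      = []
  τ (a ∷ t) = push T (G a t) (τ t)

  τ-head : ∀ a t → ∃ λ r → τ (a ∷ t) ≡ G a t ∷ r
  τ-head a t = Tᵗ.push-head (G a t) (τ t)

  τ-trail : (∀ a b t → Trail S (a ∷ b ∷ t) → G a (b ∷ t) T.≼ G b t) →
    ∀ t → Trail S t → Trail T (τ t)
  τ-trail G-mono []      _         = tt
  τ-trail G-mono (a ∷ t) a∷t-trail =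
    Tᵗ.push-trail (G a t) (τ t) (τ-trail G-mono t (trail-tail a∷t-trail)) (below-head t a∷t-trail)
    where
      below-head : ∀ t → Trail S (a ∷ t) → ∀ {y r} → τ t ≡ y ∷ r → G a t T.≼ y
      below-head (b ∷ t′) a∷t-trail τt≡y∷r =
        subst (G a (b ∷ t′) T.≼_) (proj₁ (∷-injective (trans (sym (proj₂ (τ-head b t′))) τt≡y∷r)))
          (G-mono a b t′ a∷t-trail)

  τ-extends : ∀ u s → Extends T (τ (u ++ s)) (τ s)
  τ-extends []      s = [] , refl
  τ-extends (a ∷ u) s =
    Tᵗ.extends-trans (Tᵗ.push-extends (G a (u ++ s)) (τ (u ++ s))) (τ-extends u s)

  τ-apart : (∀ a t b s → Trail S (a ∷ t) → Trail S (b ∷ s) → G a t T.# G b s → a S.# b) →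
    ∀ t s → Trail S t → Trail S s → TrailApart T (τ t) (τ s) → TrailApart S t s
  τ-apart G-reflect (a ∷ t) [] _ _ τt#τs =
    subst (λ r → TrailApart T r []) (proj₂ (τ-head a t)) τt#τs
  τ-apart G-reflect (a ∷ t) (b ∷ s) a∷t-trail b∷s-trail τt#τs =
    G-reflect a t b s a∷t-trail b∷s-trail
      (subst₂ (TrailApart T) (proj₂ (τ-head a t)) (proj₂ (τ-head b s)) τt#τs)

  τ-ψ : ∀ p w → (∀ n {a t} → ψ S p (suc n) ≡ a ∷ t → G a t ≡ w n) →
    ∀ n → τ (ψ S p n) ≡ ψ T w n
  τ-ψ p w G≡w zero    = refl
  τ-ψ p w G≡w (suc n) with push-cases (p n) (ψ S p n)
  ... | inj₁ new = trans (cong τ new) (cong₂ (push T) (G≡w n new) (τ-ψ p w G≡w n))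
  ... | inj₂ (h , t , ψₙ≡h∷t , repeat) =
    trans (cong τ repeat) (trans (τ-ψ p w G≡w n) (sym (ψ-stutters n ψₙ≡h∷t repeat)))
    where
      ψ-stutters : ∀ n → ψ S p n ≡ h ∷ t → ψ S p (suc n) ≡ ψ S p n → ψ T w (suc n) ≡ ψ T w n
      ψ-stutters (suc k) ψₖ₊₁≡h∷t repeat =
        Tᵗ.ψ-repeat w k (trans (sym (G≡w (suc k) (trans repeat ψₖ₊₁≡h∷t))) (G≡w k ψₖ₊₁≡h∷t))

-- The intermediate point w need only be ≡ₚ to g x: it is g x with its first dot dropped
-- when g and h are both trail morphisms.
IsComposite : (S T R : PreNatural) → Morphism S T → Morphism T R → Morphism S R → Set
IsComposite S T R g h f = ∀ x → Σ (Point T) λ w →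
  _≡ₚ_ T w (apply S T g x) × proj₁ (apply S R f x) ≗ proj₁ (apply T R h w)

module Composition (S T R : PreNatural) where
  private
    module S = PreNatural S
    module T = PreNatural T
  open TrailProperties S using (ψ-head)

  postcompose : Morphism S T → RefinementMorphism T R → Morphism S R
  postcompose (inj₁ g) h = inj₁ record
    { fun    = h.fun ∘ g.fun
    ; refl-# = λ a b e → g.refl-# a b (h.refl-# _ _ e)
    ; mono   = h.mono ∘ g.mono
    ; points = h.points ∘ apply S T (inj₁ g)
    }
    where
      module g = RefinementMorphism g
      module h = RefinementMorphism h
  postcompose (inj₂ g) h = inj₂ record
    { fun    = h.fun ∘ g.fun
    ; refl-# = λ t s t-trail s-trail e → g.refl-# t s t-trail s-trail (h.refl-# _ _ e)
    ; mono   = λ t s t-trail s-trail t≽s → h.mono (g.mono t s t-trail s-trail t≽s)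
    ; points = h.points ∘ apply S T (inj₂ g)
    }
    where
      module g = TrailMorphism g
      module h = RefinementMorphism h

  postcompose-apply : ∀ g h x →
    proj₁ (apply S R (postcompose g h) x) ≗ proj₁ (apply T R (inj₁ h) (apply S T g x))
  postcompose-apply (inj₁ g) h x _ = refl
  postcompose-apply (inj₂ g) h x _ = refl

  -- g as a map on nonempty trails a ∷ t (a the last dot), with, for each x, a point ≡ₚ g x
  -- listing its values along the trails of x.
  record TrailAction (g : Morphism S T) : Set where
    field
      dot       : S.Dot → List S.Dot → T.Dot
      dot-mono  : ∀ a b t → Trail S (a ∷ b ∷ t) → dot a (b ∷ t) T.≼ dot b t
      dot-apart : ∀ a t b s → Trail S (a ∷ t) → Trail S (b ∷ s) → dot a t T.# dot b s → a S.# b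
      track     : Point S → Point T
      track-≡ₚ  : ∀ x → _≡ₚ_ T (track x) (apply S T g x)
      track-ψ   : ∀ x n {a t} → ψ S (proj₁ x) (suc n) ≡ a ∷ t → dot a t ≡ proj₁ (track x) n

  trailAction : (g : Morphism S T) → TrailAction g
  trailAction (inj₁ g) = record
    { dot       = λ a _ → g.fun a
    ; dot-mono  = λ _ _ _ ((a≼b , _) , _) → g.mono a≼b
    ; dot-apart = λ a _ b _ _ _ → g.refl-# a b
    ; track     = apply S T (inj₁ g)
    ; track-≡ₚ  = λ x → PointProperties.≡ₚ-refl T {apply S T (inj₁ g) x}
    ; track-ψ   = λ x n ψ≡a∷t →
        cong g.fun (proj₁ (∷-injective (trans (sym ψ≡a∷t) (proj₂ (ψ-head (proj₁ x) n)))))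
    }
    where module g = RefinementMorphism g
  trailAction (inj₂ g) = record
    { dot       = λ a t → g.fun (a ∷ t)
    ; dot-mono  = λ a b t a∷b∷t-trail →
        g.mono _ _ a∷b∷t-trail (proj₂ a∷b∷t-trail) (a ∷ [] , refl)
    ; dot-apart = λ a t b s → g.refl-# (a ∷ t) (b ∷ s)
    ; track     = track
    ; track-≡ₚ  = λ x (n , e) → PointProperties.¬dots-apart T (g.points x) (suc n) n e
    ; track-ψ   = λ x n ψ≡a∷t → cong g.fun (sym ψ≡a∷t)
    }
    where
      module g = TrailMorphism g
      -- g x without its first dot, the image of the empty trail
      track : Point S → Point T
      track x = (λ n → g.fun (ψ S (proj₁ x) (suc n))) , Splicing.tail-point T (g.points x)

  compose-trail : (g : Morphism S T) → TrailAction g → (h : TrailMorphism T R) →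
    Σ (Morphism S R) (IsComposite S T R g (inj₂ h))
  compose-trail g G h = inj₂ composite , λ x → track x , track-≡ₚ x , cong h.fun ∘ τ-ψ-track x
    where
      open TrailAction G
      open TrailImage S T dot
      module h = TrailMorphism h
      τ-ψ-track : ∀ x n → τ (ψ S (proj₁ x) n) ≡ ψ T (proj₁ (track x)) n
      τ-ψ-track x = τ-ψ (proj₁ x) (proj₁ (track x)) (track-ψ x)
      composite : TrailMorphism S R
      composite = record
        { fun    = h.fun ∘ τ
        ; refl-# = λ t s t-trail s-trail e → τ-apart dot-apart t s t-trail s-trail
            (h.refl-# (τ t) (τ s) (τ-trail dot-mono t t-trail) (τ-trail dot-mono s s-trail) e)
        ; mono   = λ t s t-trail s-trail (u , t≡u++s) → h.mono (τ t) (τ s)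
            (τ-trail dot-mono t t-trail) (τ-trail dot-mono s s-trail)
            (subst (λ r → Extends T (τ r) (τ s)) (sym t≡u++s) (τ-extends u s))
        ; points = λ x →
            PointProperties.IsPoint-resp-≗ R (sym ∘ cong h.fun ∘ τ-ψ-track x) (h.points (track x))
        }

  compose : (g : Morphism S T) (h : Morphism T R) → Σ (Morphism S R) (IsComposite S T R g h)
  compose g (inj₁ h) = postcompose g h ,
    λ x → apply S T g x , PointProperties.≡ₚ-refl T {apply S T g x} , postcompose-apply g h x
  compose g (inj₂ h) = compose-trail g (trailAction g) h

identity : (S : PreNatural) → Morphism S S
identity S = inj₁ record
  { fun = λ a → a ; refl-# = λ _ _ a#b → a#b ; mono = λ a≼b → a≼b ; points = proj₂ }

module MorphismProperties (S T : PreNatural) where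
  private
    module T = PreNatural T
  open TrailProperties S using (ψ-head; ψ-trail; ψ-cong)
  open Splicing S using (splice-hat)

  apart-reflect : (F : Morphism S T) → ∀ x y →
    _#ₚ_ T (apply S T F x) (apply S T F y) → _#ₚ_ S x y
  apart-reflect (inj₁ f) x y (n , Fxₙ#Fyₙ) = n , RefinementMorphism.refl-# f _ _ Fxₙ#Fyₙ
  apart-reflect (inj₂ f) x y (zero , Fx₀#Fy₀) =
    ⊥-elim (TrailMorphism.refl-# f [] [] tt tt Fx₀#Fy₀)
  apart-reflect (inj₂ f) (x , x-point) (y , y-point) (suc n , Fxₙ#Fyₙ) =
    n , subst₂ (TrailApart S) (proj₂ (ψ-head x n)) (proj₂ (ψ-head y n))
          (TrailMorphism.refl-# f _ _ (ψ-trail x-point (suc n)) (ψ-trail y-point (suc n)) Fxₙ#Fyₙ)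

  ≡ₚ-preserve : (F : Morphism S T) → ∀ {x y} →
    _≡ₚ_ S x y → _≡ₚ_ T (apply S T F x) (apply S T F y)
  ≡ₚ-preserve F {x} {y} x≡y = x≡y ∘ apart-reflect F x y

  apply-local : (F : Morphism S T) → ∀ x y m → (∀ {i} → i ≤ m → proj₁ x i ≡ proj₁ y i) →
    proj₁ (apply S T F x) m ≡ proj₁ (apply S T F y) m
  apply-local (inj₁ f) x y m x≡y = cong (RefinementMorphism.fun f) (x≡y ≤-refl)
  apply-local (inj₂ f) x y m x≡y = cong (TrailMorphism.fun f) (ψ-cong m (x≡y ∘ <⇒≤))

  apply-hat : (F : Morphism S T) → ∀ y m z → hat S (proj₁ y m) z →
    Σ (Point S) λ z′ → _≡ₚ_ S z′ z × hat T (proj₁ (apply S T F y) m) (apply S T F z′)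
  apply-hat F y m z z∈ŷₘ with splice-hat y z m z∈ŷₘ
  ... | z′ , z′≡z , z′≡y with IsPoint.shrink (proj₂ (apply S T F z′)) m
  ... | j , Fz′ⱼ≺Fz′ₘ =
    z′ , z′≡z , j , subst (_ T.≺_) (apply-local F z′ y m z′≡y) Fz′ⱼ≺Fz′ₘ

  apply-bar : (F : Morphism S T) → ∀ y m z → bar S (proj₁ y m) z →
    bar T (proj₁ (apply S T F y) m) (apply S T F z)
  apply-bar F y m z (z₀ , z₀∈ŷₘ , z≡z₀) with apply-hat F y m z₀ z₀∈ŷₘ
  ... | z′ , z′≡z₀ , Fz′∈hat = apply S T F z′ , Fz′∈hat , ≡ₚ-preserve F z≡z′
    where
      open PointProperties.≡ₚ-Reasoning S
      z≡z′ : _≡ₚ_ S z z′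
      z≡z′ = begin z ≈⟨ z≡z₀ ⟩ z₀ ≈⟨ z′≡z₀ ⟨ z′ ∎

module OpenSets (S : PreNatural) where
  open PointProperties S using (≗⇒≡ₚ)

  hat-own-dot : ∀ x m → hat S (proj₁ x m) x
  hat-own-dot (_ , x-point) = IsPoint.shrink x-point

  -- y lies in the basic sets of its own dots, so only y # x could keep it out of U.
  open-resp-≡ₚ : ∀ {U x y} → IsOpen S U → U x → _≡ₚ_ S y x → U y
  open-resp-≡ₚ {x = x} {y} U-open x∈U y≡x with U-open x y x∈U
  ... | inj₁ y#x        = ⊥-elim (y≡x y#x)
  ... | inj₂ (m , ŷₘ⊆U) = ŷₘ⊆U y (hat-own-dot y m)

  BasicNbhd-resp-≗ : ∀ {a x y} → proj₁ x ≗ proj₁ y → BasicNbhd S a x → BasicNbhd S a y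
  BasicNbhd-resp-≗ {a} {x} {y} x≗y ((m , xₘ≺a) , U , U-open , x∈U , U⊆ā) =
    (m , subst (_≺ a) (x≗y m) xₘ≺a) ,
    U , U-open , open-resp-≡ₚ U-open x∈U (≗⇒≡ₚ {y} {x} (sym ∘ x≗y)) , U⊆ā
    where open PreNatural S

preimage-open : (S T : PreNatural) (g : Morphism S T) →
  ∀ {U} → IsOpen T U → IsOpen S (U ∘ apply S T g)
preimage-open S T g {U} U-open x y gx∈U with U-open (apply S T g x) (apply S T g y) gx∈U
... | inj₁ gy#gx       = inj₁ (MorphismProperties.apart-reflect S T g y x gy#gx)
... | inj₂ (m , ĝyₘ⊆U) = inj₂ (m , gz∈U)
  where
    gz∈U : ∀ z → hat S (proj₁ y m) z → U (apply S T g z)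
    gz∈U z z∈ŷₘ
      with MorphismProperties.apply-bar S T g y m z (z , z∈ŷₘ , PointProperties.≡ₚ-refl S {z})
    ... | z′ , z′∈ĝyₘ , gz≡z′ = OpenSets.open-resp-≡ₚ T U-open (ĝyₘ⊆U z′ z′∈ĝyₘ) gz≡z′

inverse-image-dots-basicNbhd : (S T : PreNatural) (g : Morphism S T) (h : Morphism T S) →
  (∀ x → _≡ₚ_ S (apply T S h (apply S T g x)) x) →
  (∀ y → _≡ₚ_ T (apply S T g (apply T S h y)) y) →
  IsBasicOpen T → ∀ w n → BasicNbhd S (proj₁ (apply T S h w) n) (apply T S h w)
inverse-image-dots-basicNbhd S T g h hg≡id gh≡id T-basic-open w n =
  hat-own-dot (apply T S h w) n , U , preimage-open S T g (T-basic-open wₙ) , hw∈U , U⊆hwₙ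
  where
    open OpenSets S using (hat-own-dot)
    open PointProperties.≡ₚ-Reasoning S
    wₙ : PreNatural.Dot T
    wₙ = proj₁ w n
    U : Point S → Set
    U x = bar T wₙ (apply S T g x)
    hw∈U : U (apply T S h w)
    hw∈U = w , OpenSets.hat-own-dot T w n , gh≡id w
    U⊆hwₙ : _⊆_ S U (bar S (proj₁ (apply T S h w) n))
    U⊆hwₙ x gx∈w̄ₙ with MorphismProperties.apply-bar T S h w n (apply S T g x) gx∈w̄ₙ
    ... | z , z∈hat , hgx≡z = z , z∈hat , (begin
      x                           ≈⟨ hg≡id x ⟨
      apply T S h (apply S T g x) ≈⟨ hgx≡z ⟩
      z                           ∎)

mainTheorem5 : (V : NaturalSpace) → BasicNbhdSpace V →
    let S = NaturalSpace.pre V in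
    Σ (Morphism S S) λ f → IsIso S S f × IsIdentical S f ×
    ((x : Point S) (n : ℕ) → BasicNbhd S (_at_ S (apply S S f x) n) (apply S S f x))
mainTheorem5 V (W , T-basic-open , g , h , hg≡id , gh≡id) =
  f , (identity S , f≡id , f≡id) , f≡id , f-dots-basicNbhd
  where
    S T : PreNatural
    S = NaturalSpace.pre V
    T = NaturalSpace.pre W
    open PointProperties S using (≗⇒≡ₚ)
    open PointProperties.≡ₚ-Reasoning S
    f-composite : Σ (Morphism S S) (IsComposite S T S g h)
    f-composite = Composition.compose S T S g h
    f : Morphism S S
    f = proj₁ f-composite
    f≡id : IsIdentical S f
    f≡id x with proj₂ f-composite x
    ... | w , w≡gx , fx≗hw = begin
      apply S S f x               ≈⟨ ≗⇒≡ₚ {apply S S f x} {apply T S h w} fx≗hw ⟩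
      apply T S h w               ≈⟨ MorphismProperties.≡ₚ-preserve T S h w≡gx ⟩
      apply T S h (apply S T g x) ≈⟨ hg≡id x ⟩
      x                           ∎
    f-dots-basicNbhd : ∀ x n → BasicNbhd S (_at_ S (apply S S f x) n) (apply S S f x)
    f-dots-basicNbhd x n with proj₂ f-composite x
    ... | w , _ , fx≗hw = subst (λ a → BasicNbhd S a (apply S S f x)) (sym (fx≗hw n))
      (OpenSets.BasicNbhd-resp-≗ S (sym ∘ fx≗hw)
        (inverse-image-dots-basicNbhd S T g h hg≡id gh≡id T-basic-open w n))
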